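{- Let $C$ be the graph consisting of a $4$-cycle $v_1v_2v_3v_4$ together with the chord $v_2v_4$. Let $L$ be a list assignment on $C$ with $|L(v_1)|\ge1$, $|L(v_3)|\ge1$, $|L(v_2)|\ge3$, $|L(v_4)|\ge3$, and $|L(u)\cap L(v)|\le 2$ for every edge $uv$ of $C$. Then $C$ has a proper coloring $\phi$ with $\phi(v)\in L(v)$ for every vertex $v$. Equivalently, the configuration $(C,X,\operatorname{ex})$ with $X=\{v_2,v_4\}$ and $\operatorname{ex}(v_2)=\operatorname{ex}(v_4)=1$ is reducible.
   Context: A configuration is a triple $(C,X,\operatorname{ex})$ where $C$ is a plane graph, $X\subseteq V(C)$, and $\operatorname{ex}:V(C)\to\{0,1,2,\infty\}$. Its list-size function is $f(v)=4-\operatorname{ex}(v)$ for $v\in X$ and $f(v)=1$ for $v\notin X$. It is reducible if for every list assignment $L$ on $C$ with $|L(v)|\ge f(v)$ for all $v$, $|L(u)\cap L(v)|\le 2$ for every edge $uv$, and $L(u)\cap L(v)=\emptyset$ for every edge $uv$ with $f(u)=f(v)=1$, the graph $C$ has a proper coloring from the lists $L$. -}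

module Defs where

open import Data.Nat using (ℕ; _≤_)
open import Data.Fin using (Fin; zero; suc)
open import Data.List using (List; []; _∷_; length; filter)
open import Data.List.Membership.Propositional using (_∈_)
open import Data.List.Membership.DecPropositional (Data.Nat._≟_) using (_∈?_)
open import Data.List.Relation.Unary.Unique.Propositional using (Unique)
open import Data.Product using (_×_; _,_; Σ)
open import Relation.Binary.PropositionalEquality using (_≢_)

-- Colours are natural numbers. A list (a finite set of colours) is a
-- duplicate-free List ℕ, so its size is its length.

v₁ v₂ v₃ v₄ : Fin 4
v₁ = zero
v₂ = suc zero
v₃ = suc (suc zero)
v₄ = suc (suc (suc zero))

data Edge : Fin 4 → Fin 4 → Set where
  e12 : Edge v₁ v₂
  e23 : Edge v₂ v₃
  e34 : Edge v₃ v₄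
  e41 : Edge v₄ v₁
  e24 : Edge v₂ v₄

_∩_ : List ℕ → List ℕ → List ℕ
A ∩ B = filter (_∈? B) A

ListAssignment : Set
ListAssignment = Fin 4 → List ℕ

ProperLColoring : ListAssignment → (Fin 4 → ℕ) → Set
ProperLColoring L φ =
  (∀ v → φ v ∈ L v) × (∀ {u v} → Edge u v → φ u ≢ φ v)

module Submission where

open import Defs
open import Data.Nat using (ℕ; _≤_; _<_; _≟_; s≤s)
open import Data.Nat.Properties using (≤-trans; <-≤-trans)
open import Data.Fin using (Fin; zero; suc)
open import Data.List using (List; []; _∷_; [_]; _++_; length; filter)
open import Data.List.Properties using (filter-notAll)
open import Data.List.Relation.Unary.All as All using (All; []; _∷_)
open import Data.List.Relation.Unary.All.Properties using (¬Any⇒All¬)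
open import Data.List.Relation.Unary.Any as Any using (Any; here; there)
open import Data.List.Relation.Unary.Any.Properties using (++⁺ˡ; ++⁺ʳ)
open import Data.List.Relation.Unary.AllPairs using (_∷_)
open import Data.List.Relation.Unary.Unique.Propositional using (Unique)
open import Data.List.Membership.Propositional using (_∈_; _∉_)
open import Data.List.Membership.Propositional.Properties using (∈-filter⁺)
open import Data.List.Membership.DecPropositional (Data.Nat._≟_) using (_∈?_)
open import Data.Product using (Σ; ∃; ∃-syntax; _×_; _,_)
open import Relation.Nullary using (yes; no; ¬?)
open import Relation.Unary using (Decidable)
open import Relation.Binary.PropositionalEquality using (refl; sym; _≢_)

-- Pick any colour a ∈ L(v₁), c ∈ L(v₃). Since |L(v₂) ∩ L(v₄)| ≤ 2 < |L(v₂)|,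
-- some colour y ∈ L(v₂) is missing from L(v₄). Choose the colour b of v₂ in
-- L(v₂) ∖ {a, c} so that one of a, c, b lies outside L(v₄): take b = y if
-- y ∉ {a, c}, and any admissible b otherwise. Then at most two of the three
-- colours a, c, b forbidden at v₄ occur in L(v₄), so |L(v₄)| ≥ 3 leaves a colour.

1≤length⇒∃∈ : {xs : List ℕ} → 1 ≤ length xs → ∃ (_∈ xs)
1≤length⇒∃∈ {x ∷ _} _ = x , here refl

length<⇒∃∈∉ : {xs ys : List ℕ} → Unique xs → length ys < length xs →
              ∃[ z ] z ∈ xs × z ∉ ys
length<⇒∃∈∉ {x ∷ xs} {ys} (x≢xs ∷ !xs) (s≤s |ys|≤|xs|) with x ∈? ys
... | no x∉ys = x , here refl , x∉ys
... | yes x∈ys =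
  let z , z∈xs , z∉ys′ = length<⇒∃∈∉ !xs (<-≤-trans |ys′|<|ys| |ys|≤|xs|)
  in z , there z∈xs , λ z∈ys → z∉ys′ (∈-filter⁺ ≢x? z∈ys (All.lookup x≢xs z∈xs))
  where
  ≢x? : Decidable (x ≢_)
  ≢x? y = ¬? (x ≟ y)
  |ys′|<|ys| : length (filter ≢x? ys) < length ys
  |ys′|<|ys| = filter-notAll ≢x? ys (Any.map (λ x≡y x≢y → x≢y x≡y) x∈ys)

length∩<⇒∃∈∉ : {xs ys : List ℕ} → Unique xs → length (xs ∩ ys) < length xs →
               ∃[ z ] z ∈ xs × z ∉ ys
length∩<⇒∃∈∉ {ys = ys} !xs |xs∩ys|<|xs| =
  let z , z∈xs , z∉xs∩ys = length<⇒∃∈∉ !xs |xs∩ys|<|xs|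
  in z , z∈xs , λ z∈ys → z∉xs∩ys (∈-filter⁺ (_∈? ys) z∈xs z∈ys)

length≤⇒∃∈∉ : {xs ys : List ℕ} → Unique xs → length ys ≤ length xs →
              Any (_∉ xs) ys → ∃[ z ] z ∈ xs × z ∉ ys
length≤⇒∃∈∉ {xs} {ys} !xs |ys|≤|xs| outsider =
  let z , z∈xs , z∉ys∩xs = length<⇒∃∈∉ !xs (<-≤-trans |ys∩xs|<|ys| |ys|≤|xs|)
  in z , z∈xs , λ z∈ys → z∉ys∩xs (∈-filter⁺ (_∈? xs) z∈ys z∈xs)
  where
  |ys∩xs|<|ys| : length (ys ∩ xs) < length ys
  |ys∩xs|<|ys| = filter-notAll (_∈? xs) ys outsider

∃∈∉-keeping-outsider : {xs ys ex : List ℕ} {y : ℕ} → Unique xs →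
                       length ex < length xs → y ∈ xs → y ∉ ys →
                       ∃[ z ] z ∈ xs × z ∉ ex × Any (_∉ ys) (ex ++ [ z ])
∃∈∉-keeping-outsider {ex = ex} {y} !xs |ex|<|xs| y∈xs y∉ys with y ∈? ex
... | no y∉ex = y , y∈xs , y∉ex , ++⁺ʳ ex (here y∉ys)
... | yes y∈ex with z , z∈xs , z∉ex ← length<⇒∃∈∉ !xs |ex|<|xs|
  = z , z∈xs , z∉ex , ++⁺ˡ (Any.map (λ { refl → y∉ys }) y∈ex)

diamond-coloring : (L : ListAssignment) {a c b d : ℕ} →
                   a ∈ L v₁ → c ∈ L v₃ → b ∈ L v₂ → d ∈ L v₄ →
                   All (b ≢_) (a ∷ c ∷ []) → All (d ≢_) (a ∷ c ∷ b ∷ []) →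
                   Σ (Fin 4 → ℕ) (ProperLColoring L)
diamond-coloring L {a} {c} {b} {d} a∈ c∈ b∈ d∈
                 (b≢a ∷ b≢c ∷ []) (d≢a ∷ d≢c ∷ d≢b ∷ []) = φ , φ∈L , φ-proper
  where
  φ : Fin 4 → ℕ
  φ zero                   = a
  φ (suc zero)             = b
  φ (suc (suc zero))       = c
  φ (suc (suc (suc zero))) = d

  φ∈L : ∀ v → φ v ∈ L v
  φ∈L zero                   = a∈
  φ∈L (suc zero)             = b∈
  φ∈L (suc (suc zero))       = c∈
  φ∈L (suc (suc (suc zero))) = d∈

  φ-proper : ∀ {u v} → Edge u v → φ u ≢ φ v
  φ-proper e12 = λ a≡b → b≢a (sym a≡b)
  φ-proper e23 = b≢c
  φ-proper e34 = λ c≡d → d≢c (sym c≡d)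
  φ-proper e41 = d≢a
  φ-proper e24 = λ b≡d → d≢b (sym b≡d)

lemma3p6 : (L : ListAssignment) →
    (∀ v → Unique (L v)) →
    1 ≤ length (L v₁) → 1 ≤ length (L v₃) →
    3 ≤ length (L v₂) → 3 ≤ length (L v₄) →
    (∀ {u v} → Edge u v → length (L u ∩ L v) ≤ 2) →
    Σ (Fin 4 → ℕ) (λ φ → ProperLColoring L φ)
lemma3p6 L unique |L₁|≥1 |L₃|≥1 |L₂|≥3 |L₄|≥3 |L∩L|≤2 =
  let a , a∈L₁ = 1≤length⇒∃∈ |L₁|≥1
      c , c∈L₃ = 1≤length⇒∃∈ |L₃|≥1
      y , y∈L₂ , y∉L₄ =
        length∩<⇒∃∈∉ (unique v₂) (≤-trans (s≤s (|L∩L|≤2 e24)) |L₂|≥3)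
      b , b∈L₂ , b∉ac , outsider =
        ∃∈∉-keeping-outsider {ex = a ∷ c ∷ []} (unique v₂) |L₂|≥3 y∈L₂ y∉L₄
      d , d∈L₄ , d∉acb = length≤⇒∃∈∉ (unique v₄) |L₄|≥3 outsider
  in diamond-coloring L a∈L₁ c∈L₃ b∈L₂ d∈L₄ (¬Any⇒All¬ _ b∉ac) (¬Any⇒All¬ _ d∉acb)
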